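{- Let $P$ be a finite poset, $P^*\subseteq P$ a subset containing all minimal and all maximal elements of $P$, and $\lambda:P^*\to\mathbb R$ order-preserving. Let $L=(\emptyset=I_0\subsetneq I_1\subsetneq\cdots\subsetneq I_{m+1}=P)$ be a $\lambda$-admissible chain of order ideals, and let $L_k$ be a $\lambda$-admissible chain obtained from $L$ by adding a single order ideal $J_k$ with $I_{k-1}\subsetneq J_k\subsetneq I_k$. Then $\dim L_k=\dim L+1$.
   Context: An order ideal of $P$ is a subset $I$ such that $x\in I$, $y\preceq x$ imply $y\in I$. A chain of order ideals $L=(\emptyset=I_0\subsetneq\cdots\subsetneq I_{m+1}=P)$ is $\lambda$-admissible if for every $i$ the set $\lambda((I_i\setminus I_{i-1})\cap P^*)$ is either empty or a singleton $\{t_i\}$, and $t_i<t_j$ whenever $i<j$ and both are defined. The dimension $\dim L$ of such a chain is the number of indices $i\in\{1,\dots,m+1\}$ with $(I_i\setminus I_{i-1})\cap P^*=\emptyset$. -}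

module Defs where

open import Level using (Level; 0ℓ)
open import Data.Nat as ℕ using (ℕ; zero; suc)
open import Data.Bool as B using (Bool; true; false; if_then_else_)
open import Data.Fin as Fin using (Fin; zero; suc; inject₁; fromℕ)
open import Data.Fin.Subset using (Subset; _∈_; _⊂_; _∩_; _─_; ⊥; ⊤; Nonempty)
open import Data.Vec using (Vec; lookup)
open import Data.Vec.Properties using (≡-dec)
open import Data.Product using (Σ; _×_; _,_)
open import Data.Sum using (_⊎_)
open import Relation.Nullary using (Dec; yes; no)
open import Relation.Binary using (Rel; StrictTotalOrder)
open import Relation.Binary.PropositionalEquality using (_≡_)

module _ {n : ℕ} (_≼_ : Rel (Fin n) 0ℓ) where

  IsMinimal : Fin n → Set
  IsMinimal x = ∀ y → y ≼ x → y ≡ x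

  IsMaximal : Fin n → Set
  IsMaximal x = ∀ y → x ≼ y → y ≡ x

  ContainsMinMax : Subset n → Set
  ContainsMinMax P* = (∀ x → IsMinimal x → x ∈ P*) × (∀ x → IsMaximal x → x ∈ P*)

  IsOrderIdeal : Subset n → Set
  IsOrderIdeal I = ∀ x y → x ∈ I → y ≼ x → y ∈ I

  IsIdealChain : {m : ℕ} → Vec (Subset n) (suc (suc m)) → Set
  IsIdealChain {m} I =
    lookup I zero ≡ ⊥ × lookup I (fromℕ (suc m)) ≡ ⊤ ×
    (∀ (j : Fin (suc m)) → lookup I (inject₁ j) ⊂ lookup I (suc j)) ×
    (∀ i → IsOrderIdeal (lookup I i))

-- λ : P* → T order-preserving, with T a strict total order (e.g. ℝ).
module _ {a ℓ₁ ℓ₂ : Level} (T : StrictTotalOrder a ℓ₁ ℓ₂) where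
  open StrictTotalOrder T renaming (Carrier to A)

  OrderPreserving : {n : ℕ} → Rel (Fin n) 0ℓ → (P* : Subset n) →
                    ((x : Fin n) → x ∈ P* → A) → Set (ℓ₁ Level.⊔ ℓ₂)
  OrderPreserving _≼_ P* lam =
    ∀ x y (hx : x ∈ P*) (hy : y ∈ P*) → x ≼ y → (lam x hx < lam y hy) ⊎ (lam x hx ≈ lam y hy)

  module _ {n : ℕ} (_≼_ : Rel (Fin n) 0ℓ) (P* : Subset n)
           (lam : (x : Fin n) → x ∈ P* → A) {m : ℕ}
           (I : Vec (Subset n) (suc (suc m))) where

    -- (I_{j+1} \ I_j) ∩ P*   for j = 0 … m  (the i-th block with i = j+1)
    block* : Fin (suc m) → Subset n
    block* j = (lookup I (suc j) ─ lookup I (inject₁ j)) ∩ P*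

    BlockEmpty : Fin (suc m) → Set
    BlockEmpty j = block* j ≡ ⊥

    BlockValue : Fin (suc m) → A → Set ℓ₁
    BlockValue j t = Nonempty (block* j) × (∀ x (hx : x ∈ P*) → x ∈ block* j → lam x hx ≈ t)

    IsAdmissible : Set (a Level.⊔ ℓ₁ Level.⊔ ℓ₂)
    IsAdmissible =
      IsIdealChain _≼_ I ×
      (∀ j → BlockEmpty j ⊎ Σ A (BlockValue j)) ×
      (∀ i j t s → i Fin.< j → BlockValue i t → BlockValue j s → t < s)

countFin : {k : ℕ} → (Fin k → Bool) → ℕ
countFin {zero} f = zero
countFin {suc k} f = (if f zero then 1 else 0) ℕ.+ countFin (λ j → f (suc j))

isEmptyBlock : {n m : ℕ} (P* : Subset n) (I : Vec (Subset n) (suc (suc m))) → Fin (suc m) → Bool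
isEmptyBlock P* I j with ≡-dec B._≟_ ((lookup I (suc j) ─ lookup I (inject₁ j)) ∩ P*) ⊥
... | yes _ = true
... | no _ = false

dim : {n m : ℕ} (P* : Subset n) (I : Vec (Subset n) (suc (suc m))) → ℕ
dim P* I = countFin (isEmptyBlock P* I)

{-# OPTIONS --safe #-}
-- The block (I_k ∖ I_{k-1}) ∩ P* of L is covered by the two blocks (J_k ∖ I_{k-1}) ∩ P*
-- and (I_k ∖ J_k) ∩ P* of L_k that replace it, and every other block is unchanged.
-- If the old block is empty, so are both new ones, and one empty block is added.
-- Otherwise λ is constant on the old block, whereas admissibility of L_k makes λ strictly
-- larger on the second new block than on the first; so they cannot both be nonempty, and
-- exactly one of them is empty — again one empty block more.
module Submission where

open import Defs
open import Level using (0ℓ)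
open import Data.Nat using (ℕ; suc)
open import Data.Fin using (Fin; suc; inject₁)
open import Data.Fin.Subset using (Subset; _∈_; _⊂_)
open import Data.Vec using (Vec; lookup; insertAt)
open import Relation.Binary using (Rel; StrictTotalOrder; IsPartialOrder)
open import Relation.Binary.PropositionalEquality using (_≡_)

open import Data.Bool using (Bool; if_then_else_)
open import Data.Bool.Properties using () renaming (_≟_ to _≟ᵇ_)
open import Data.Fin using (zero; _<_)
open import Data.Fin.Properties using (toℕ-inject₁)
open import Data.Fin.Subset using (_⊆_; _─_; _∩_; _∪_; _∉_; ⊥; Nonempty; outside)
open import Data.Fin.Subset.Properties
  using (Empty-unique; ⊆-refl; ⊆-antisym; ⊥⊆; ∪-identityˡ; x∈p∩q⁺; x∈p∩q⁻; x∈p∪q⁺;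
         x∈p∧x∉q⇒x∈p─q; p─q⊆p; ∉⊥; _∈?_; nonempty?)
open import Data.Nat using (zero; _+_; s≤s)
open import Data.Nat.Properties using (+-assoc; +-suc; ≤-reflexive)
open import Data.Product using (Σ; _×_; _,_; proj₁; proj₂)
open import Data.Sum using (inj₁; inj₂)
open import Data.Vec using (_∷_; here; there)
open import Data.Vec.Properties using (≡-dec; insertAt-lookup)
open import Function using (_∘_)
open import Relation.Nullary using (Dec; yes; no; ¬_; contradiction)
open import Relation.Nullary.Decidable using (isYes; decidable-stable)
open import Relation.Binary.PropositionalEquality using (refl; sym; trans; cong; cong₂; subst; module ≡-Reasoning)

private variable
  n m : ℕ
  A B J P* : Subset n
  x : Fin n

-- block* T _≼_ P* lam I j reduces to block P* (lookup I (inject₁ j)) (lookup I (suc j)).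
block : Subset n → Subset n → Subset n → Subset n
block P* A B = (B ─ A) ∩ P*

x∈p─q⇒x∉q : (p q : Subset n) → x ∈ p ─ q → x ∉ q
x∈p─q⇒x∉q (_ ∷ p) (outside ∷ q) here          ()
x∈p─q⇒x∉q (_ ∷ p) (_       ∷ q) (there x∈p─q) (there x∈q) = x∈p─q⇒x∉q p q x∈p─q x∈q

x∈block⁻ : (P* A B : Subset n) → x ∈ block P* A B → x ∈ B × x ∉ A × x ∈ P*
x∈block⁻ P* A B x∈AB with x∈p∩q⁻ (B ─ A) P* x∈AB
... | x∈B─A , x∈P* = p─q⊆p B A x∈B─A , x∈p─q⇒x∉q B A x∈B─A , x∈P*

x∈block⁺ : x ∈ B → x ∉ A → x ∈ P* → x ∈ block P* A B
x∈block⁺ x∈B x∉A x∈P* = x∈p∩q⁺ (x∈p∧x∉q⇒x∈p─q x∈B x∉A , x∈P*)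

block-mono : {A′ B′ : Subset n} → A′ ⊆ A → B ⊆ B′ → block P* A B ⊆ block P* A′ B′
block-mono {A = A} {B = B} {P* = P*} A′⊆A B⊆B′ x∈AB with x∈block⁻ P* A B x∈AB
... | x∈B , x∉A , x∈P* = x∈block⁺ (B⊆B′ x∈B) (x∉A ∘ A′⊆A) x∈P*

block⊆block∪block : block P* A B ⊆ block P* A J ∪ block P* J B
block⊆block∪block {P* = P*} {A = A} {B = B} {J = J} {x = x} x∈AB with x∈block⁻ P* A B x∈AB | x ∈? J
... | x∈B , x∉A , x∈P* | yes x∈J = x∈p∪q⁺ (inj₁ (x∈block⁺ x∈J x∉A x∈P*))
... | x∈B , x∉A , x∈P* | no  x∉J = x∈p∪q⁺ (inj₂ (x∈block⁺ x∈B x∉J x∈P*))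

⊆⊥⇒≡⊥ : {p q : Subset n} → p ⊆ q → q ≡ ⊥ → p ≡ ⊥
⊆⊥⇒≡⊥ p⊆q refl = ⊆-antisym p⊆q ⊥⊆

≢⊥⇒Nonempty : {p : Subset n} → ¬ p ≡ ⊥ → Nonempty p
≢⊥⇒Nonempty {p = p} p≢⊥ = decidable-stable (nonempty? p) (p≢⊥ ∘ Empty-unique)

boolToℕ : Bool → ℕ
boolToℕ b = if b then 1 else 0

isYes-split : {X Y Z : Set} (x? : Dec X) (y? : Dec Y) (z? : Dec Z) →
              (Z → X × Y) → (X × Y → Z) → ¬ (¬ X × ¬ Y) →
              boolToℕ (isYes x?) + boolToℕ (isYes y?) ≡ suc (boolToℕ (isYes z?))
isYes-split (yes _) (yes _)  (yes _)  _    _    _      = refl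
isYes-split (no ¬x) _        (yes z)  to   _    _      = contradiction (proj₁ (to z)) ¬x
isYes-split (yes _) (no ¬y)  (yes z)  to   _    _      = contradiction (proj₂ (to z)) ¬y
isYes-split (yes x) (yes y)  (no ¬z)  _    from _      = contradiction (from (x , y)) ¬z
isYes-split (yes _) (no _)   (no _)   _    _    _      = refl
isYes-split (no _)  (yes _)  (no _)   _    _    _      = refl
isYes-split (no ¬x) (no ¬y)  (no _)   _    _    ¬both  = contradiction (¬x , ¬y) ¬both

countFin-cong : {k : ℕ} {f g : Fin k → Bool} → (∀ j → f j ≡ g j) → countFin f ≡ countFin g
countFin-cong {zero}  f≗g = refl
countFin-cong {suc k} f≗g = cong₂ (λ b c → boolToℕ b + c) (f≗g zero) (countFin-cong (f≗g ∘ suc))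

countAdjacent : {X : Set} → (X → X → Bool) → Vec X (suc m) → ℕ
countAdjacent f I = countFin (λ j → f (lookup I (inject₁ j)) (lookup I (suc j)))

countAdjacent-insertAt : {X : Set} (f : X → X → Bool) (I : Vec X (suc (suc m))) (k : Fin (suc m)) (J : X) →
  boolToℕ (f (lookup I (inject₁ k)) J) + boolToℕ (f J (lookup I (suc k))) ≡
    suc (boolToℕ (f (lookup I (inject₁ k)) (lookup I (suc k)))) →
  countAdjacent f (insertAt I (suc (inject₁ k)) J) ≡ suc (countAdjacent f I)
countAdjacent-insertAt f (a ∷ b ∷ I) zero J split = begin
  boolToℕ (f a J) + (boolToℕ (f J b) + rest)  ≡⟨ +-assoc (boolToℕ (f a J)) _ rest ⟨
  boolToℕ (f a J) + boolToℕ (f J b) + rest    ≡⟨ cong (_+ rest) split ⟩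
  suc (boolToℕ (f a b) + rest)                ∎
  where
  open ≡-Reasoning
  rest = countAdjacent f (b ∷ I)
countAdjacent-insertAt {m = suc m} f (a ∷ b ∷ I) (suc k) J split = begin
  boolToℕ (f a b) + countAdjacent f (insertAt (b ∷ I) (suc (inject₁ k)) J)
    ≡⟨ cong (boolToℕ (f a b) +_) (countAdjacent-insertAt f (b ∷ I) k J split) ⟩
  boolToℕ (f a b) + suc (countAdjacent f (b ∷ I))
    ≡⟨ +-suc _ _ ⟩
  suc (boolToℕ (f a b) + countAdjacent f (b ∷ I))
    ∎
  where open ≡-Reasoning

blockEmpty : Subset n → Subset n → Subset n → Bool
blockEmpty P* A B = isYes (≡-dec _≟ᵇ_ (block P* A B) ⊥)

isEmptyBlock≡blockEmpty : (P* : Subset n) (I : Vec (Subset n) (suc (suc m))) (j : Fin (suc m)) →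
  isEmptyBlock P* I j ≡ blockEmpty P* (lookup I (inject₁ j)) (lookup I (suc j))
isEmptyBlock≡blockEmpty P* I j with ≡-dec _≟ᵇ_ (block P* (lookup I (inject₁ j)) (lookup I (suc j))) ⊥
... | yes _ = refl
... | no  _ = refl

dim≡countAdjacent : (P* : Subset n) (I : Vec (Subset n) (suc (suc m))) →
                    dim P* I ≡ countAdjacent (blockEmpty P*) I
dim≡countAdjacent P* I = countFin-cong (isEmptyBlock≡blockEmpty P* I)

blockEmpty-split : (P* : Subset n) → A ⊆ J → J ⊆ B →
  ¬ (Nonempty (block P* A J) × Nonempty (block P* J B)) →
  boolToℕ (blockEmpty P* A J) + boolToℕ (blockEmpty P* J B) ≡ suc (boolToℕ (blockEmpty P* A B))
blockEmpty-split {A = A} {J = J} {B = B} P* A⊆J J⊆B notBoth =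
  isYes-split (≡-dec _≟ᵇ_ _ ⊥) (≡-dec _≟ᵇ_ _ ⊥) (≡-dec _≟ᵇ_ _ ⊥) to from
    (λ (AJ≢⊥ , JB≢⊥) → notBoth (≢⊥⇒Nonempty AJ≢⊥ , ≢⊥⇒Nonempty JB≢⊥))
  where
  to : block P* A B ≡ ⊥ → block P* A J ≡ ⊥ × block P* J B ≡ ⊥
  to AB≡⊥ = ⊆⊥⇒≡⊥ (block-mono ⊆-refl J⊆B) AB≡⊥ , ⊆⊥⇒≡⊥ (block-mono A⊆J ⊆-refl) AB≡⊥
  from : block P* A J ≡ ⊥ × block P* J B ≡ ⊥ → block P* A B ≡ ⊥
  from (AJ≡⊥ , JB≡⊥) = ⊆⊥⇒≡⊥ (block⊆block∪block {J = J}) (trans (cong₂ _∪_ AJ≡⊥ JB≡⊥) (∪-identityˡ ⊥))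

insertAt-lookup-inject₁ : {X : Set} (xs : Vec X (suc n)) (i : Fin (suc n)) (v : X) →
                          lookup (insertAt xs (suc i) v) (inject₁ i) ≡ lookup xs i
insertAt-lookup-inject₁             (x ∷ xs) zero    v = refl
insertAt-lookup-inject₁ {n = suc n} (x ∷ xs) (suc i) v = insertAt-lookup-inject₁ xs i v

insertAt-lookup-suc : {X : Set} (xs : Vec X n) (i : Fin n) (v : X) →
                      lookup (insertAt xs (inject₁ i) v) (suc i) ≡ lookup xs i
insertAt-lookup-suc (x ∷ xs) zero    v = refl
insertAt-lookup-suc (x ∷ xs) (suc i) v = insertAt-lookup-suc xs i v

inject₁<suc : (i : Fin n) → inject₁ i < suc i
inject₁<suc i = s≤s (≤-reflexive (toℕ-inject₁ i))

module _ {a ℓ₁ ℓ₂} (T : StrictTotalOrder a ℓ₁ ℓ₂) (_≼_ : Rel (Fin n) 0ℓ)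
         {lam : (x : Fin n) → x ∈ P* → StrictTotalOrder.Carrier T} where
  open StrictTotalOrder T using (Carrier; _≈_; irrefl; <-respˡ-≈; <-respʳ-≈)
    renaming (_<_ to _<ᵀ_; module Eq to ≈)

  module _ (I : Vec (Subset n) (suc (suc m))) (adm : IsAdmissible T _≼_ P* lam I) where

    admissible-blockValue : ∀ {j x} → x ∈ block* T _≼_ P* lam I j →
                            Σ Carrier (BlockValue T _≼_ P* lam I j)
    admissible-blockValue {j} x∈block with proj₁ (proj₂ adm) j
    ... | inj₁ block≡⊥ = contradiction (subst (_ ∈_) block≡⊥ x∈block) ∉⊥
    ... | inj₂ value   = value

    admissible-lam-≈ : ∀ {j x y} (x∈P* : x ∈ P*) (y∈P* : y ∈ P*) →
      x ∈ block* T _≼_ P* lam I j → y ∈ block* T _≼_ P* lam I j → lam x x∈P* ≈ lam y y∈P*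
    admissible-lam-≈ x∈P* y∈P* x∈block y∈block with admissible-blockValue x∈block
    ... | t , _ , λ≈t = ≈.trans (λ≈t _ x∈P* x∈block) (≈.sym (λ≈t _ y∈P* y∈block))

    admissible-lam-< : ∀ {i j x y} (x∈P* : x ∈ P*) (y∈P* : y ∈ P*) → i < j →
      x ∈ block* T _≼_ P* lam I i → y ∈ block* T _≼_ P* lam I j → lam x x∈P* <ᵀ lam y y∈P*
    admissible-lam-< x∈P* y∈P* i<j x∈block y∈block
      with admissible-blockValue x∈block | admissible-blockValue y∈block
    ... | t , vt@(_ , λ≈t) | s , vs@(_ , λ≈s) =
      <-respʳ-≈ (≈.sym (λ≈s _ y∈P* y∈block)) (<-respˡ-≈ (≈.sym (λ≈t _ x∈P* x∈block))
        (proj₂ (proj₂ adm) _ _ t s i<j vt vs))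

  insertAt-blocks-not-both-nonempty :
    (I : Vec (Subset n) (suc (suc m))) (k : Fin (suc m)) (J : Subset n) →
    IsAdmissible T _≼_ P* lam I → IsAdmissible T _≼_ P* lam (insertAt I (suc (inject₁ k)) J) →
    lookup I (inject₁ k) ⊆ J → J ⊆ lookup I (suc k) →
    ¬ (Nonempty (block P* (lookup I (inject₁ k)) J) × Nonempty (block P* J (lookup I (suc k))))
  insertAt-blocks-not-both-nonempty I k J adm adm′ A⊆J J⊆B ((x , x∈AJ) , (y , y∈JB)) =
    irrefl (admissible-lam-≈ I adm {k} x∈P* y∈P* (block-mono ⊆-refl J⊆B x∈AJ) (block-mono A⊆J ⊆-refl y∈JB))
           (admissible-lam-< (insertAt I (suc (inject₁ k)) J) adm′ x∈P* y∈P* (inject₁<suc k) x∈left y∈right)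
    where
    x∈P* = proj₂ (proj₂ (x∈block⁻ P* _ J x∈AJ))
    y∈P* = proj₂ (proj₂ (x∈block⁻ P* J _ y∈JB))
    x∈left : x ∈ block* T _≼_ P* lam (insertAt I (suc (inject₁ k)) J) (inject₁ k)
    x∈left = subst (x ∈_) (sym (cong₂ (block P*) (insertAt-lookup-inject₁ I (inject₁ k) J)
                                               (insertAt-lookup I (suc (inject₁ k)) J))) x∈AJ
    y∈right : y ∈ block* T _≼_ P* lam (insertAt I (suc (inject₁ k)) J) (suc k)
    y∈right = subst (y ∈_) (sym (cong₂ (block P*) (insertAt-lookup I (suc (inject₁ k)) J)
                                                (insertAt-lookup-suc I (suc k) J))) y∈JB

lemma3p4 : ∀ {a ℓ₁ ℓ₂} (T : StrictTotalOrder a ℓ₁ ℓ₂)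
    (n : ℕ) (_≼_ : Rel (Fin n) 0ℓ) → IsPartialOrder _≡_ _≼_ →
    (P* : Subset n) → ContainsMinMax _≼_ P* →
    (lam : (x : Fin n) → x ∈ P* → StrictTotalOrder.Carrier T) →
    OrderPreserving T _≼_ P* lam →
    (m : ℕ) (I : Vec (Subset n) (suc (suc m))) →
    IsAdmissible T _≼_ P* lam I →
    (k : Fin (suc m)) (J : Subset n) →
    lookup I (inject₁ k) ⊂ J → J ⊂ lookup I (suc k) →
    IsAdmissible T _≼_ P* lam (insertAt I (suc (inject₁ k)) J) →
    dim P* (insertAt I (suc (inject₁ k)) J) ≡ suc (dim P* I)
lemma3p4 T n _≼_ _ P* _ lam _ m I adm k J (A⊆J , _) (J⊆B , _) adm′ = begin
  dim P* I′                              ≡⟨ dim≡countAdjacent P* I′ ⟩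
  countAdjacent (blockEmpty P*) I′       ≡⟨ countAdjacent-insertAt (blockEmpty P*) I k J split ⟩
  suc (countAdjacent (blockEmpty P*) I)  ≡⟨ cong suc (dim≡countAdjacent P* I) ⟨
  suc (dim P* I)                         ∎
  where
  open ≡-Reasoning
  I′ = insertAt I (suc (inject₁ k)) J
  split = blockEmpty-split P* A⊆J J⊆B
            (insertAt-blocks-not-both-nonempty T _≼_ I k J adm adm′ A⊆J J⊆B)
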